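{- Let $(S,\to,s^0)$ be a finite labeled transition system over a finite action set ${\sf Act}$ containing $\tau$, let $\langle A_?,A_>\rangle$ be a well-founded partition of ${\sf Act}$ for it with $\tau\in A_>$, let $\pi_0:S\to\mathbb{N}$ be arbitrary, let $h_1,h_2,\dots:\mathbb{N}\times{\sf Sig}\to\mathbb{N}$ be bijections, and let $pre_{i+1}$, $sig_{i+1}$, $\pi_{i+1}$ be the inductive branching signatures and partitions defined in the context. Then for every $i\ge 0$ and every state $s\in S$: (1) If there exist $t_1,t_2\in S$ with $s\xrightarrow{\tau}t_1$, $s\xrightarrow{\tau}t_2$, $\pi_i(s)=\pi_i(t_1)=\pi_i(t_2)$, $pre_{i+1}(s)\subseteq sig_{i+1}(t_1)\cup\{(\tau,\pi_{i+1}(t_1))\}$ and $pre_{i+1}(s)\subseteq sig_{i+1}(t_2)\cup\{(\tau,\pi_{i+1}(t_2))\}$, then $sig_{i+1}(t_1)=sig_{i+1}(t_2)$. (2) If $(a,n)\in sig_{i+1}(s)$, then there exist $m\ge 0$ and states $s_1,\dots,s_m,t$ with $s\xrightarrow{\tau}s_1\xrightarrow{\tau}\cdots\xrightarrow{\tau}s_m\xrightarrow{a}t$, $\pi_i(s)=\pi_i(s_j)$ for all $j=1,\dots,m$, and $n=\pi_{i+\hat a}(t)$, where $\hat a=0$ if $a\in A_?$ and $\hat a=1$ if $a\in A_>$.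
   Context: A labeled transition system (LTS) is a triple $(S,\to,s^0)$ with $\to\subseteq S\times{\sf Act}\times S$; write $s\xrightarrow{a}t$ for $(s,a,t)\in\to$. Here $S$ and ${\sf Act}$ are finite and $\tau\in{\sf Act}$ is the invisible action. ${\sf Sig}$ is the set of finite subsets of ${\sf Act}\times\mathbb{N}$. A well-founded partition of ${\sf Act}$ for the LTS is a pair $\langle A_?,A_>\rangle$ with $A_?\cap A_>=\emptyset$, $A_?\cup A_>={\sf Act}$, such that there is no cycle of transitions labeled with actions in $A_>$; let $>$ be the transitive closure of $\bigcup_{a\in A_>}\xrightarrow{a}$ (a well-founded order on $S$). Given $\pi_i:S\to\mathbb{N}$, define $pre_{i+1}$, $sig_{i+1}$, $\pi_{i+1}$ simultaneously by well-founded recursion on $>$: $pre_{i+1}(s)=\{(a,\pi_i(t))\mid s\xrightarrow{a}t,\ a\in A_?\}\cup\{(a,\pi_{i+1}(t))\mid s\xrightarrow{a}t,\ a\in A_>\}$; $sig_{i+1}(s)=sig_{i+1}(t)$ for some (chosen) $t$ with $s\xrightarrow{\tau}t$, $\pi_i(s)=\pi_i(t)$ and $pre_{i+1}(s)\subseteq sig_{i+1}(t)\cup\{(\tau,\pi_{i+1}(t))\}$, if such a $t$ exists; otherwise $sig_{i+1}(s)=pre_{i+1}(s)$; $\pi_{i+1}(s)=h_{i+1}(\pi_i(s),sig_{i+1}(s))$. -}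

module Defs where

open import Data.Nat using (ℕ; zero; suc; _+_)
open import Data.Fin using (Fin)
open import Data.Fin.Base using () 
open import Data.List using (List; []; _∷_; [_]; concatMap; allFin)
open import Data.List.Membership.Propositional using (_∈_)
open import Data.List.Relation.Binary.Subset.Propositional using (_⊆_)
open import Data.Bool using (Bool; true; false; if_then_else_)
open import Data.Product using (Σ; _×_; _,_; ∃; ∃-syntax)
open import Data.Sum using (_⊎_)
open import Relation.Binary.PropositionalEquality using (_≡_)
open import Relation.Binary.Construct.Closure.Transitive using (TransClosure)
open import Relation.Nullary using (¬_)

-- An LTS with state set S = Fin nS and action set Act = Fin nA is given by a
-- (decidable, as every relation on a finite set) transition relation
--   step s a t ≡ true   iff   s --a--> t.
Trans : ℕ → ℕ → Set
Trans nS nA = Fin nS → Fin nA → Fin nS → Bool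

-- Sig: finite subsets of Act × ℕ, represented by lists, considered up to
-- set equality _≋_ (same elements).
Sig : ℕ → Set
Sig nA = List (Fin nA × ℕ)

_≋_ : ∀ {nA} → Sig nA → Sig nA → Set
A ≋ B = (A ⊆ B) × (B ⊆ A)

record IsSigBijection {nA : ℕ} (f : ℕ → Sig nA → ℕ) : Set where
  field
    respects   : ∀ n (A B : Sig nA) → A ≋ B → f n A ≡ f n B
    injective  : ∀ n m (A B : Sig nA) → f n A ≡ f m B → (n ≡ m) × (A ≋ B)
    surjective : ∀ k → ∃[ n ] ∃[ A ] (f n A ≡ k)

-- The partition: A_> = {a | isGT a ≡ true}, A_? = {a | isGT a ≡ false}
-- (disjoint and covering by construction).
-- One A_>-labelled transition step.
GTStep : ∀ {nS nA} → Trans nS nA → (Fin nA → Bool) → Fin nS → Fin nS → Set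
GTStep step isGT s t = ∃[ a ] ((isGT a ≡ true) × (step s a t ≡ true))

WellFoundedPartition : ∀ {nS nA} → Trans nS nA → (Fin nA → Bool) → Set
WellFoundedPartition {nS} step isGT =
  ∀ (s : Fin nS) → ¬ TransClosure (GTStep step isGT) s s

hat : ∀ {nA} → (Fin nA → Bool) → Fin nA → ℕ
hat isGT a = if isGT a then 1 else 0

pre : ∀ {nS nA} → Trans nS nA → (Fin nA → Bool) →
      (πi πi1 : Fin nS → ℕ) → Fin nS → Sig nA
pre {nS} {nA} step isGT πi πi1 s =
  concatMap (λ a → concatMap (λ t →
      if step s a t
        then [ (a , (if isGT a then πi1 t else πi t)) ]
        else [])
    (allFin nS)) (allFin nA)

-- The side condition on a τ-successor t of s (π i = π_i, sig i = sig_{i+1}):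
-- s -τ-> t, π_i(s) = π_i(t), pre_{i+1}(s) ⊆ sig_{i+1}(t) ∪ {(τ, π_{i+1}(t))}.
Cond : ∀ {nS nA} → Trans nS nA → Fin nA → (Fin nA → Bool) →
       (π : ℕ → Fin nS → ℕ) → (sig : ℕ → Fin nS → Sig nA) →
       ℕ → Fin nS → Fin nS → Set
Cond step τ isGT π sig i s t =
  (step s τ t ≡ true) × (π i s ≡ π i t) ×
  (pre step isGT (π i) (π (suc i)) s ⊆ ((τ , π (suc i) t) ∷ sig i t))

SigSpec : ∀ {nS nA} → Trans nS nA → Fin nA → (Fin nA → Bool) →
          (π : ℕ → Fin nS → ℕ) → (sig : ℕ → Fin nS → Sig nA) →
          ℕ → Fin nS → Set
SigSpec step τ isGT π sig i s =
  (∃[ t ] (Cond step τ isGT π sig i s t × (sig i s ≋ sig i t)))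
  ⊎ ((∀ t → ¬ Cond step τ isGT π sig i s t) ×
     (sig i s ≋ pre step isGT (π i) (π (suc i)) s))

data TauPath {nS nA : ℕ} (step : Trans nS nA) (τ : Fin nA) (P : Fin nS → Set)
     : Fin nS → Fin nS → Set where
  here : ∀ {s} → TauPath step τ P s s
  next : ∀ {s s′ u} → step s τ s′ ≡ true → P s′ →
         TauPath step τ P s′ u → TauPath step τ P s u

-- Since h_{i+1} is injective, equal π_{i+1}-values force equal signatures. Every
-- element (a , n) of sig_{i+1}(s) either lies in pre_{i+1}(s) or is inherited from a
-- τ-successor in the same π_i-class, so well-founded induction along > unfolds it into a
-- τ-path followed by an a-step; this is (2). For (1), suppose t₁ and t₂ satisfy the side
-- condition but sig_{i+1}(t₁) ≠ sig_{i+1}(t₂). As τ ∈ A_>, (τ , π_{i+1}(t₁)) ∈ pre_{i+1}(s)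
-- must then lie in sig_{i+1}(t₂) and symmetrically, so t₁ and t₂ are "mutual". By (2),
-- (τ , π_{i+1}(t₁)) ∈ sig_{i+1}(t₂) yields some w < t₂ with π_{i+1}(w) = π_{i+1}(t₁), and
-- then t₂ and w are mutual again: an infinite descent in the well-founded order >.
module Submission where

open import Defs
open import Data.Nat using (ℕ; zero; suc; _+_; z<s; s<s)
open import Data.Nat.Properties using (+-comm; +-identityʳ; n<1+n)
open import Data.Fin using (Fin; zero; suc; _<_)
open import Data.Fin.Properties using (pigeonhole)
open import Data.Bool using (Bool; true; false; if_then_else_)
open import Data.Product using (_×_; _,_; ∃-syntax; proj₁; proj₂)
open import Data.Sum using (inj₁; inj₂)
open import Data.Empty using (⊥-elim)
open import Data.List using ([]; [_]; allFin)
open import Data.List.Membership.Propositional using (_∈_; lose)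
open import Data.List.Membership.Propositional.Properties
  using (∈-concatMap⁺; ∈-concatMap⁻; ∈-allFin)
open import Data.List.Relation.Unary.Any using (here; there; satisfied)
open import Function using (flip)
open import Relation.Binary.Core using (Rel)
open import Relation.Binary.PropositionalEquality using (_≡_; refl; sym; trans; cong; subst)
open import Relation.Binary.Construct.Closure.Transitive using (TransClosure; _∷_; _∷ʳ_)
  renaming ([_] to [_]⁺)
import Relation.Binary.Construct.Closure.Transitive as Transitive
open import Relation.Nullary using (¬_)
open import Induction.WellFounded using (WellFounded; Acc; acc)
open import Induction.InfiniteDescent using (descent∧wf⇒empty)

module _ {n ℓ} {_⟶_ : Rel (Fin n) ℓ} where

  data Walk : ℕ → Fin n → Set ℓ where
    []  : ∀ {x} → Walk 0 x
    _∷_ : ∀ {k x y} → x ⟶ y → Walk k y → Walk (suc k) x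

  vertex : ∀ {k x} → Walk k x → Fin (suc k) → Fin n
  vertex {x = x} w       zero    = x
  vertex         (_ ∷ w) (suc j) = vertex w j

  vertex-⁺ : ∀ {k x} (w : Walk k x) {i j} → i < j →
             TransClosure _⟶_ (vertex w i) (vertex w j)
  vertex-⁺ (r ∷ w) {zero}  {suc zero}    _         = [ r ]⁺
  vertex-⁺ (r ∷ w) {zero}  {suc (suc j)} _         = r ∷ vertex-⁺ w {zero} {suc j} z<s
  vertex-⁺ (r ∷ w) {suc i} {suc j}       (s<s i<j) = vertex-⁺ w i<j

  acyclic⇒¬walk : (∀ x → ¬ TransClosure _⟶_ x x) → ∀ x → ¬ Walk n x
  acyclic⇒¬walk acyclic x w with pigeonhole (n<1+n n) (vertex w)
  ... | i , j , i<j , wᵢ≡wⱼ =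
    acyclic (vertex w j) (subst (λ v → TransClosure _⟶_ v (vertex w j)) wᵢ≡wⱼ (vertex-⁺ w i<j))

  ¬walk⇒acc : ∀ k x → ¬ Walk k x → Acc (flip _⟶_) x
  ¬walk⇒acc zero    x ¬w = ⊥-elim (¬w [])
  ¬walk⇒acc (suc k) x ¬w = acc λ {y} x⟶y → ¬walk⇒acc k y (λ w → ¬w (x⟶y ∷ w))

  acyclic⇒wellFounded : (∀ x → ¬ TransClosure _⟶_ x x) → WellFounded (flip _⟶_)
  acyclic⇒wellFounded acyclic x = ¬walk⇒acc n x (acyclic⇒¬walk acyclic x)

∈-if-[]⁻ : ∀ {A : Set} {b} {x y : A} → y ∈ (if b then [ x ] else []) → b ≡ true × y ≡ x
∈-if-[]⁻ {b = true} (here y≡x) = refl , y≡x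

∈-if-[]⁺ : ∀ {A : Set} {b} {x : A} → b ≡ true → x ∈ (if b then [ x ] else [])
∈-if-[]⁺ refl = here refl

module _ {nS nA} (step : Trans nS nA) (isGT : Fin nA → Bool) (πa πb : Fin nS → ℕ) where

  label : Fin nA → Fin nS → ℕ
  label a t = if isGT a then πb t else πa t

  ∈-pre⁻ : ∀ {s a n} → (a , n) ∈ pre step isGT πa πb s →
           ∃[ t ] (step s a t ≡ true × n ≡ label a t)
  ∈-pre⁻ a,n∈pre with satisfied (∈-concatMap⁻ _ {xs = allFin nA} a,n∈pre)
  ... | a′ , a,n∈preₐ′ with satisfied (∈-concatMap⁻ _ {xs = allFin nS} a,n∈preₐ′)
  ...   | t , a,n∈preₐ′ₜ with ∈-if-[]⁻ {b = step _ a′ t} a,n∈preₐ′ₜ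
  ...     | st , refl = t , st , refl

  ∈-pre⁺ : ∀ {s a t} → step s a t ≡ true → (a , label a t) ∈ pre step isGT πa πb s
  ∈-pre⁺ {a = a} {t} st =
    ∈-concatMap⁺ _ (lose (∈-allFin a) (∈-concatMap⁺ _ (lose (∈-allFin t) (∈-if-[]⁺ st))))

module Refinement {nS nA} (step : Trans nS nA) (τ : Fin nA) (isGT : Fin nA → Bool)
         (wfp : WellFoundedPartition step isGT) (τ∈A> : isGT τ ≡ true)
         (π : ℕ → Fin nS → ℕ) (sig : ℕ → Fin nS → Sig nA) (i : ℕ)
         (hᵢ : ℕ → Sig nA → ℕ) (hᵢ-bijective : IsSigBijection hᵢ)
         (spec : ∀ s → SigSpec step τ isGT π sig i s)
         (π-suc : ∀ s → π (suc i) s ≡ hᵢ (π i s) (sig i s)) where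

  _≺_ : Fin nS → Fin nS → Set
  _≺_ = flip (GTStep step isGT)

  ≺-wellFounded : WellFounded _≺_
  ≺-wellFounded = acyclic⇒wellFounded wfp

  sig-injective : ∀ {x y} → π (suc i) x ≡ π (suc i) y → sig i x ≋ sig i y
  sig-injective {x} {y} eq = proj₂ (IsSigBijection.injective hᵢ-bijective _ _ _ _
    (trans (sym (π-suc x)) (trans eq (π-suc y))))

  label≡π-hat : ∀ a t → label step isGT (π i) (π (suc i)) a t ≡ π (i + hat isGT a) t
  label≡π-hat a t with isGT a
  ... | true  = cong (λ k → π k t) (+-comm 1 i)
  ... | false = cong (λ k → π k t) (sym (+-identityʳ i))

  SigWitness : ℕ → Fin nS → Fin nA → ℕ → Set
  SigWitness c x a n = ∃[ u ] ∃[ t ] (TauPath step τ (λ z → c ≡ π i z) x u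
                         × (step u a t ≡ true) × (n ≡ π (i + hat isGT a) t))

  sig-witnessed : ∀ {c x a n} → Acc _≺_ x → c ≡ π i x → (a , n) ∈ sig i x → SigWitness c x a n
  sig-witnessed {x = x} (acc rec) c≡πx a,n∈sig with spec x
  ... | inj₁ (t , (x⟶t , πx≡πt , _) , sigx≋sigt)
      with sig-witnessed (rec (τ , τ∈A> , x⟶t)) (trans c≡πx πx≡πt) (proj₁ sigx≋sigt a,n∈sig)
  ...   | u , t′ , path , u⟶t′ , n≡ = u , t′ , next x⟶t (trans c≡πx πx≡πt) path , u⟶t′ , n≡
  sig-witnessed (acc rec) c≡πx a,n∈sig | inj₂ (_ , sigx≋pre)
      with ∈-pre⁻ step isGT (π i) (π (suc i)) (proj₁ sigx≋pre a,n∈sig)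
  ...   | t , x⟶t , n≡ = _ , t , here , x⟶t , trans n≡ (label≡π-hat _ t)

  τ-path⁺ : ∀ {P x u w} → TauPath step τ P x u → step u τ w ≡ true → TransClosure _≺_ w x
  τ-path⁺ here           u⟶w = [ τ , τ∈A> , u⟶w ]⁺
  τ-path⁺ (next x⟶y _ p) u⟶w = τ-path⁺ p u⟶w ∷ʳ (τ , τ∈A> , x⟶y)

  π-hat-τ : ∀ w → π (i + hat isGT τ) w ≡ π (suc i) w
  π-hat-τ w = trans (cong (λ b → π (i + (if b then 1 else 0)) w) τ∈A>)
                    (cong (λ k → π k w) (+-comm i 1))

  τ-in-sig : ∀ {x n} → (τ , n) ∈ sig i x → ∃[ w ] (TransClosure _≺_ w x × n ≡ π (suc i) w)
  τ-in-sig {x} τ,n∈sig with sig-witnessed (≺-wellFounded x) refl τ,n∈sig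
  ... | _ , w , path , u⟶w , n≡ = w , τ-path⁺ path u⟶w , trans n≡ (π-hat-τ w)

  Mutual : Fin nS → Fin nS → Set
  Mutual p q = ((τ , π (suc i) q) ∈ sig i p) × ((τ , π (suc i) p) ∈ sig i q)

  mutual-descends : ∀ {p q} → Mutual p q → ∃[ w ] (TransClosure _≺_ w q × Mutual q w)
  mutual-descends {p} {q} (τ,πq∈sigp , τ,πp∈sigq) with τ-in-sig τ,πp∈sigq
  ... | w , w≺⁺q , πp≡πw =
    w , w≺⁺q , subst (λ k → (τ , k) ∈ sig i q) πp≡πw τ,πp∈sigq
             , proj₁ (sig-injective πp≡πw) τ,πq∈sigp

  ¬mutual : ∀ p q → ¬ Mutual p q
  ¬mutual p q m = descent∧wf⇒empty descends (Transitive.wellFounded _≺_ ≺-wellFounded) q (p , m)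
    where
    descends : ∀ {q} → ∃[ p ] Mutual p q → ∃[ w ] (TransClosure _≺_ w q × ∃[ p ] Mutual p w)
    descends (p , m) with mutual-descends m
    ... | w , w≺⁺q , m′ = w , w≺⁺q , _ , m′

  τ∈pre : ∀ {s t} → step s τ t ≡ true → (τ , π (suc i) t) ∈ pre step isGT (π i) (π (suc i)) s
  τ∈pre {s} {t} s⟶t = subst (λ n → (τ , n) ∈ pre step isGT (π i) (π (suc i)) s)
                            (trans (label≡π-hat τ t) (π-hat-τ t))
                            (∈-pre⁺ step isGT (π i) (π (suc i)) s⟶t)

  sig-unique : ∀ {s t₁ t₂} → Cond step τ isGT π sig i s t₁ → Cond step τ isGT π sig i s t₂ →
               sig i t₁ ≋ sig i t₂
  sig-unique (s⟶t₁ , _ , pre⊆₁) (s⟶t₂ , _ , pre⊆₂)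
    with pre⊆₂ (τ∈pre s⟶t₁) | pre⊆₁ (τ∈pre s⟶t₂)
  ... | here eq  | _        = sig-injective (cong proj₂ eq)
  ... | there _  | here eq  = sig-injective (sym (cong proj₂ eq))
  ... | there m₁ | there m₂ = ⊥-elim (¬mutual _ _ (m₁ , m₂))

proposition2 : ∀ {nS nA : ℕ} (step : Trans nS nA) (s⁰ : Fin nS) (τ : Fin nA)
    (isGT : Fin nA → Bool) → WellFoundedPartition step isGT → isGT τ ≡ true →
    (π : ℕ → Fin nS → ℕ) (h : ℕ → ℕ → Sig nA → ℕ) → (∀ i → IsSigBijection (h i)) →
    (sig : ℕ → Fin nS → Sig nA) →
    (∀ i s → SigSpec step τ isGT π sig i s) →
    (∀ i s → π (suc i) s ≡ h i (π i s) (sig i s)) →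
    ∀ (i : ℕ) (s : Fin nS) →
      (∀ t₁ t₂ → Cond step τ isGT π sig i s t₁ → Cond step τ isGT π sig i s t₂ →
        sig i t₁ ≋ sig i t₂)
      × (∀ a n → (a , n) ∈ sig i s →
        ∃[ u ] ∃[ t ] (TauPath step τ (λ x → π i s ≡ π i x) s u
          × (step u a t ≡ true) × (n ≡ π (i + hat isGT a) t)))
proposition2 step _ τ isGT wfp τ∈A> π h h-bijective sig spec π-suc i s =
  (λ _ _ → sig-unique)
  , λ _ _ → sig-witnessed (≺-wellFounded s) refl
  where open Refinement step τ isGT wfp τ∈A> π sig i (h i) (h-bijective i) (spec i) (π-suc i)
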